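{- Let $\mathcal{L_N}$ and $\mathcal{L_Q}$ be Steiner loops with $|\mathcal{L_N}|=u+1$, $|\mathcal{L_Q}|=w+1$, and let $\mathcal{L_S}$ be the Steiner loop on $\mathcal{L_Q}\times\mathcal{L_N}$ with operation $(P,x)\circ(Q,y)=(PQ,\Phi_{P,Q}(x,y))$ for a Steiner operator $\Phi$. Regard the $(u+1)(w+1)\times(u+1)(w+1)$ multiplication table of $\mathcal{L_S}$ as the array of $(w+1)^2$ blocks $\Phi_{P,Q}$ of size $(u+1)\times(u+1)$, $P,Q\in\mathcal{L_Q}$. Then the whole table is completely determined by its $w+1$ diagonal (symmetric) blocks $\Phi_{P,P}$, $P\in\mathcal{L_Q}$, together with $\frac{w(w-1)}{6}$ additional blocks, namely one block $\Phi_{P,Q}$ for each triple $\{P,Q,PQ\}$ of the Steiner triple system $\mathcal{Q}=\mathcal{L_Q}\setminus\{\bar\Omega\}$.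
   Context: A Steiner loop is the loop $\mathcal{S}\cup\{\Omega\}$ of a Steiner triple system $\mathcal{S}$ (points with triples such that every 2-subset lies in exactly one triple), with product: for distinct points, the third point of their triple; $xx=\Omega$; $x\Omega=\Omega x=x$. With identities $\Omega'\in\mathcal{L_N}$, $\bar\Omega\in\mathcal{L_Q}$, a Steiner operator is a map assigning to each $(P,Q)\in\mathcal{L_Q}^2$ a Latin square $\Phi_{P,Q}:\mathcal{L_N}\times\mathcal{L_N}\to\mathcal{L_N}$ such that for all $P,Q,x,y$: (i) $\Phi_{\bar\Omega,\bar\Omega}$ is the multiplication of $\mathcal{L_N}$; (ii) $\Phi_{Q,P}(y,x)=\Phi_{P,Q}(x,y)$; (iii) $\Phi_{P,P}(x,x)=\Omega'$; (iv) $\Phi_{P,PQ}(x,\Phi_{P,Q}(x,y))=y$. The resulting $\mathcal{L_S}$ is a Steiner loop with normal subloop $\{(\bar\Omega,x)\}\cong\mathcal{L_N}$ and quotient $\mathcal{L_Q}$. -}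

module Defs where

open import Data.Nat using (ℕ; suc)
open import Data.Fin using (Fin)
open import Data.Sum using (_⊎_)
open import Data.Product using (_×_; ∃!; _,_)
open import Relation.Binary.PropositionalEquality using (_≡_)
open import Relation.Nullary using (¬_)

-- We use the
-- standard equational characterisation of the loop S ∪ {Ω} of an STS S:
-- Ω is the identity, the product is commutative, x x = Ω and x (x y) = y.
-- (For distinct non-identity x, y these force x y to be the third point of
-- a triple {x, y, x y}, and the triples form an STS on Fin (suc n) ∖ {Ω}.)
record SteinerLoop (n : ℕ) : Set where
  field
    Ω      : Fin (suc n)
    _∙_    : Fin (suc n) → Fin (suc n) → Fin (suc n)
    identˡ : ∀ x → Ω ∙ x ≡ x
    identʳ : ∀ x → x ∙ Ω ≡ x
    comm   : ∀ x y → x ∙ y ≡ y ∙ x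
    sqr    : ∀ x → x ∙ x ≡ Ω
    cancel : ∀ x y → x ∙ (x ∙ y) ≡ y

IsLatinSquare : {A : Set} → (A → A → A) → Set
IsLatinSquare {A} f =
  (∀ x z → ∃! _≡_ (λ y → f x y ≡ z)) × (∀ y z → ∃! _≡_ (λ x → f x y ≡ z))

record IsSteinerOperator {u w : ℕ} (LN : SteinerLoop u) (LQ : SteinerLoop w)
       (Φ : Fin (suc w) → Fin (suc w) → Fin (suc u) → Fin (suc u) → Fin (suc u))
       : Set where
  open SteinerLoop LN renaming (Ω to Ω′; _∙_ to _·N_)
  open SteinerLoop LQ renaming (Ω to Ω̄; _∙_ to _·Q_)
  field
    latin   : ∀ P Q → IsLatinSquare (Φ P Q)
    base    : ∀ x y → Φ Ω̄ Ω̄ x y ≡ x ·N y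
    symm    : ∀ P Q x y → Φ Q P y x ≡ Φ P Q x y
    diagSq  : ∀ P x → Φ P P x x ≡ Ω′
    inverse : ∀ P Q x y → Φ P (P ·Q Q) x (Φ P Q x y) ≡ y

InTriple : {w : ℕ} (LQ : SteinerLoop w) → Fin (suc w) → Fin (suc w) → Fin (suc w) → Set
InTriple LQ P Q R = (R ≡ P) ⊎ ((R ≡ Q) ⊎ (R ≡ SteinerLoop._∙_ LQ P Q))

-- A choice of one block per triple {P, Q, PQ} of the STS L_Q ∖ {Ω̄}:
-- σ P Q is an ordered pair of distinct points of the triple containing P, Q
-- (for distinct non-identity P, Q), and σ depends only on that triple.
record IsTripleSelection {w : ℕ} (LQ : SteinerLoop w)
       (σ : Fin (suc w) → Fin (suc w) → Fin (suc w) × Fin (suc w)) : Set where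
  open SteinerLoop LQ renaming (Ω to Ω̄; _∙_ to _·Q_)
  field
    inTriple : ∀ P Q → ¬ P ≡ Ω̄ → ¬ Q ≡ Ω̄ → ¬ P ≡ Q →
               let (R , S) = σ P Q in InTriple LQ P Q R × InTriple LQ P Q S × ¬ R ≡ S
    swapInv  : ∀ P Q → ¬ P ≡ Ω̄ → ¬ Q ≡ Ω̄ → ¬ P ≡ Q → σ Q P ≡ σ P Q
    thirdInv : ∀ P Q → ¬ P ≡ Ω̄ → ¬ Q ≡ Ω̄ → ¬ P ≡ Q → σ P (P ·Q Q) ≡ σ P Q

{-# OPTIONS --safe #-}
-- A block Φ P Q determines its transpose Φ Q P by symmetry, and the block
-- Φ P (P Q) as well: by the inverse law, each row of Φ P (P Q) is the inverse
-- of the corresponding (bijective) row of Φ P Q.  Swapping and passing to the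
-- third point act transitively on the six ordered pairs of distinct points of
-- a triple {P, Q, P Q}, so one block per triple fixes all off-diagonal blocks
-- between non-identity points; the remaining blocks Φ P Ω̄ = Φ P (P P) and
-- Φ Ω̄ P are determined by the diagonal block Φ P P.
module Submission where

open import Defs
open import Data.Nat using (ℕ; suc)
open import Data.Fin using (Fin)
open import Data.Fin.Properties using (_≟_)
open import Data.Product using (_×_; _,_; proj₁; proj₂; ∃)
open import Data.Sum using (inj₁; inj₂)
open import Relation.Binary.PropositionalEquality
  using (_≡_; _≢_; _≗_; refl; cong; module ≡-Reasoning)
open import Relation.Nullary using (¬_; yes; no; contradiction)

leftInverse-unique : {A B : Set} {g g′ : A → B} {f f′ : B → A} →
                     (∀ b → ∃ λ a → g a ≡ b) → g ≗ g′ →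
                     (∀ a → f (g a) ≡ a) → (∀ a → f′ (g′ a) ≡ a) → f ≗ f′
leftInverse-unique {g = g} {g′} {f} {f′} g-surjective g≗g′ f∘g≗id f′∘g′≗id b
  with g-surjective b
... | a , refl = begin
  f (g a)    ≡⟨ f∘g≗id a ⟩
  a          ≡⟨ f′∘g′≗id a ⟨
  f′ (g′ a)  ≡⟨ cong f′ (g≗g′ a) ⟨
  f′ (g a)   ∎
  where open ≡-Reasoning

module _ {n : ℕ} (L : SteinerLoop n) where
  open SteinerLoop L

  cancelʳ : ∀ x y → y ∙ (x ∙ y) ≡ x
  cancelʳ x y = begin
    y ∙ (x ∙ y)  ≡⟨ cong (y ∙_) (comm x y) ⟩
    y ∙ (y ∙ x)  ≡⟨ cancel y x ⟩
    x            ∎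
    where open ≡-Reasoning

module BlockAgreement {u w : ℕ} {LN : SteinerLoop u} {LQ : SteinerLoop w}
    {Φ Ψ : Fin (suc w) → Fin (suc w) → Fin (suc u) → Fin (suc u) → Fin (suc u)}
    (Φ-op : IsSteinerOperator LN LQ Φ) (Ψ-op : IsSteinerOperator LN LQ Ψ) where
  open SteinerLoop LQ renaming (Ω to Ω̄)
  private
    module Φ = IsSteinerOperator Φ-op
    module Ψ = IsSteinerOperator Ψ-op

  BlocksAgree : Fin (suc w) → Fin (suc w) → Set
  BlocksAgree P Q = ∀ x y → Φ P Q x y ≡ Ψ P Q x y

  blocksAgree-swap : ∀ {P Q} → BlocksAgree P Q → BlocksAgree Q P
  blocksAgree-swap {P} {Q} PQ y x = begin
    Φ Q P y x  ≡⟨ Φ.symm P Q x y ⟩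
    Φ P Q x y  ≡⟨ PQ x y ⟩
    Ψ P Q x y  ≡⟨ Ψ.symm P Q x y ⟨
    Ψ Q P y x  ∎
    where open ≡-Reasoning

  blocksAgree-third : ∀ {P Q R} → BlocksAgree P Q → P ∙ Q ≡ R → BlocksAgree P R
  blocksAgree-third {P} {Q} PQ refl x =
    leftInverse-unique row-surjective (PQ x) (Φ.inverse P Q x) (Ψ.inverse P Q x)
    where
    row-surjective : ∀ z → ∃ λ y → Φ P Q x y ≡ z
    row-surjective z with proj₁ (Φ.latin P Q) x z
    ... | y , Φxy≡z , _ = y , Φxy≡z

  blocksAgree-identity : ∀ {P} → BlocksAgree P P → BlocksAgree P Ω̄
  blocksAgree-identity {P} PP = blocksAgree-third PP (sqr P)

  blocksAgree-withinTriple : ∀ {P Q R S} → InTriple LQ P Q R → InTriple LQ P Q S → R ≢ S →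
                             BlocksAgree R S → BlocksAgree P Q
  blocksAgree-withinTriple (inj₁ refl)        (inj₁ refl)        R≢S = contradiction refl R≢S
  blocksAgree-withinTriple (inj₁ refl)        (inj₂ (inj₁ refl)) R≢S RS = RS
  blocksAgree-withinTriple {P} {Q} (inj₁ refl) (inj₂ (inj₂ refl)) R≢S RS =
    blocksAgree-third RS (cancel P Q)
  blocksAgree-withinTriple (inj₂ (inj₁ refl)) (inj₁ refl)        R≢S RS = blocksAgree-swap RS
  blocksAgree-withinTriple (inj₂ (inj₁ refl)) (inj₂ (inj₁ refl)) R≢S = contradiction refl R≢S
  blocksAgree-withinTriple {P} {Q} (inj₂ (inj₁ refl)) (inj₂ (inj₂ refl)) R≢S RS =
    blocksAgree-swap (blocksAgree-third RS (cancelʳ LQ P Q))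
  blocksAgree-withinTriple {P} {Q} (inj₂ (inj₂ refl)) (inj₁ refl) R≢S RS =
    blocksAgree-third (blocksAgree-swap RS) (cancel P Q)
  blocksAgree-withinTriple {P} {Q} (inj₂ (inj₂ refl)) (inj₂ (inj₁ refl)) R≢S RS =
    blocksAgree-swap (blocksAgree-third (blocksAgree-swap RS) (cancelʳ LQ P Q))
  blocksAgree-withinTriple (inj₂ (inj₂ refl)) (inj₂ (inj₂ refl)) R≢S = contradiction refl R≢S

mainTheorem15 : {u w : ℕ} (LN : SteinerLoop u) (LQ : SteinerLoop w)
    (Φ Ψ : Fin (suc w) → Fin (suc w) → Fin (suc u) → Fin (suc u) → Fin (suc u)) →
    IsSteinerOperator LN LQ Φ → IsSteinerOperator LN LQ Ψ →
    (σ : Fin (suc w) → Fin (suc w) → Fin (suc w) × Fin (suc w)) → IsTripleSelection LQ σ →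
    (∀ P x y → Φ P P x y ≡ Ψ P P x y) →
    (∀ P Q → ¬ P ≡ SteinerLoop.Ω LQ → ¬ Q ≡ SteinerLoop.Ω LQ → ¬ P ≡ Q →
      ∀ x y → Φ (proj₁ (σ P Q)) (proj₂ (σ P Q)) x y ≡ Ψ (proj₁ (σ P Q)) (proj₂ (σ P Q)) x y) →
    ∀ P Q x y → Φ P Q x y ≡ Ψ P Q x y
mainTheorem15 LN LQ Φ Ψ Φ-op Ψ-op σ σ-selection diagonal selected = blocksAgree
  where
  open SteinerLoop LQ renaming (Ω to Ω̄)
  open BlockAgreement Φ-op Ψ-op

  blocksAgree : ∀ P Q → BlocksAgree P Q
  blocksAgree P Q with P ≟ Q | P ≟ Ω̄ | Q ≟ Ω̄
  ... | yes refl | _        | _        = diagonal P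
  ... | no _     | yes refl | _        = blocksAgree-swap (blocksAgree-identity (diagonal Q))
  ... | no _     | no _     | yes refl = blocksAgree-identity (diagonal P)
  ... | no P≢Q   | no P≢Ω̄   | no Q≢Ω̄   =
    let R∈ , S∈ , R≢S = IsTripleSelection.inTriple σ-selection P Q P≢Ω̄ Q≢Ω̄ P≢Q
    in  blocksAgree-withinTriple R∈ S∈ R≢S (selected P Q P≢Ω̄ Q≢Ω̄ P≢Q)
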